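{- Let $G$ be a connected graph with $n\geq 5$ vertices. Then $$\max\{\chi(G)-1,\gamma(G)\}\leq\Omega_{uc}(G)\leq\min\left\{\tfrac{3}{2}(\chi(G)-1)\gamma(G),\ i(G)\chi(G)\right\}\leq\tfrac14 n^2.$$ Moreover, $\chi(G)-1=\Omega_{uc}(G)$ if and only if $G$ is a cone graph, i.e. there is a vertex whose closed neighborhood is the whole vertex set.
   Context: Graphs are finite, simple and undirected. A coloring of $G=(V,E)$ is a map $c:V\to\{0,1,2,\dots\}$ with $c(u)\neq c(v)$ whenever $u,v$ are adjacent. Given $(G,c)$, a set $D\subseteq V$ is an up--color dominating $c$--set if (1) every vertex $v\notin D$ has a neighbor $d\in D$ with $c(v)<c(d)$, and (2) $D$ contains no vertex of color $0$. The weight of $D$ is $\sum_{v\in D}c(v)$, and $\omega_{uc}(G,c)$ is the minimum weight of an up--color dominating $c$--set. $\Omega_{uc}(G)$ is the minimum of $\omega_{uc}(G,c)$ over all colorings $c$ of $G$. $\chi(G)$ is the chromatic number, $\gamma(G)$ the domination number, and $i(G)$ the independent domination number (minimum size of an independent dominating set). -}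

module Defs where

open import Data.Nat using (ℕ; zero; suc; _+_; _*_; _∸_; _≤_; _<_)
open import Data.Fin using (Fin)
open import Data.Bool using (Bool; true; false; if_then_else_)
open import Data.List using (List; map; allFin)
open import Data.Nat.ListAction using (sum)
open import Data.Product using (Σ; ∃; _×_; _,_)
open import Data.Sum using (_⊎_)
open import Relation.Binary.PropositionalEquality using (_≡_)
open import Relation.Nullary using (¬_)

record Graph (n : ℕ) : Set where
  field
    edge  : Fin n → Fin n → Bool
    sym   : ∀ u v → edge u v ≡ edge v u
    irrefl : ∀ v → edge v v ≡ false

open Graph public

Adj : ∀ {n} → Graph n → Fin n → Fin n → Set
Adj G u v = edge G u v ≡ true

data Reach {n : ℕ} (G : Graph n) : Fin n → Fin n → Set where
  here : ∀ {v} → Reach G v v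
  step : ∀ {u w v} → Adj G u w → Reach G w v → Reach G u v

Connected : ∀ {n} → Graph n → Set
Connected {n} G = ∀ (u v : Fin n) → Reach G u v

IsColoring : ∀ {n} → Graph n → (Fin n → ℕ) → Set
IsColoring {n} G c = ∀ (u v : Fin n) → Adj G u v → ¬ (c u ≡ c v)

Subset : ℕ → Set
Subset n = Fin n → Bool

_∈ₛ_ : ∀ {n} → Fin n → Subset n → Set
v ∈ₛ D = D v ≡ true

_∉ₛ_ : ∀ {n} → Fin n → Subset n → Set
v ∉ₛ D = D v ≡ false

weight : ∀ {n} → (Fin n → ℕ) → Subset n → ℕ
weight {n} c D = sum (map (λ v → if D v then c v else 0) (allFin n))

size : ∀ {n} → Subset n → ℕ
size D = weight (λ _ → 1) D

IsUCDSet : ∀ {n} → Graph n → (Fin n → ℕ) → Subset n → Set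
IsUCDSet {n} G c D =
  (∀ (v : Fin n) → v ∉ₛ D → Σ (Fin n) λ d → d ∈ₛ D × Adj G v d × c v < c d)
  × (∀ (v : Fin n) → v ∈ₛ D → ¬ (c v ≡ 0))

IsOmegaUC : ∀ {n} → Graph n → (Fin n → ℕ) → ℕ → Set
IsOmegaUC {n} G c w =
  (Σ (Subset n) λ D → IsUCDSet G c D × weight c D ≡ w)
  × (∀ (D : Subset n) → IsUCDSet G c D → w ≤ weight c D)

IsBigOmegaUC : ∀ {n} → Graph n → ℕ → Set
IsBigOmegaUC {n} G w =
  (Σ (Fin n → ℕ) λ c → IsColoring G c × IsOmegaUC G c w)
  × (∀ (c : Fin n → ℕ) (w' : ℕ) → IsColoring G c → IsOmegaUC G c w' → w ≤ w')

ColorableWith : ∀ {n} → Graph n → ℕ → Set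
ColorableWith {n} G k = Σ (Fin n → ℕ) λ c → IsColoring G c × (∀ v → c v < k)

IsChromatic : ∀ {n} → Graph n → ℕ → Set
IsChromatic G k = ColorableWith G k × (∀ m → ColorableWith G m → k ≤ m)

IsDominating : ∀ {n} → Graph n → Subset n → Set
IsDominating {n} G D =
  ∀ (v : Fin n) → v ∉ₛ D → Σ (Fin n) λ d → d ∈ₛ D × Adj G v d

IsIndependent : ∀ {n} → Graph n → Subset n → Set
IsIndependent {n} G D = ∀ (u v : Fin n) → u ∈ₛ D → v ∈ₛ D → ¬ Adj G u v

IsDomNumber : ∀ {n} → Graph n → ℕ → Set
IsDomNumber {n} G k =
  (Σ (Subset n) λ D → IsDominating G D × size D ≡ k)
  × (∀ (D : Subset n) → IsDominating G D → k ≤ size D)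

IsIndDomNumber : ∀ {n} → Graph n → ℕ → Set
IsIndDomNumber {n} G k =
  (Σ (Subset n) λ D → IsIndependent G D × IsDominating G D × size D ≡ k)
  × (∀ (D : Subset n) → IsIndependent G D → IsDominating G D → k ≤ size D)

IsCone : ∀ {n} → Graph n → Set
IsCone {n} G = Σ (Fin n) λ v → ∀ (u : Fin n) → u ≡ v ⊎ Adj G v u

{-# OPTIONS --safe #-}
module Submission where

-- Lower bounds: for an optimal colouring c with optimal set D, the vertex m of largest colour lies in D,
-- so Ω ≥ c m ≥ χ − 1; and D dominates with weights ≥ 1, so Ω ≥ γ. If Ω = χ − 1 then D = {m}, so m is
-- adjacent to everything; conversely, recolouring a cone so that its apex gets colour χ − 1 makes the
-- apex alone an up-colour dominating set.
-- Upper bounds: with k = χ − 1, giving a minimum dominating set S the colours 2k − c or 2k − (k − c)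
-- costs 3kγ for both together, and giving a minimum independent dominating set the colour χ costs ιχ.
-- For 4ιχ ≤ n², take a maximal independent set I through a vertex v of maximum degree. If two vertices
-- p, q outside I are non-adjacent, colour V ∖ I injectively except that p and q share a colour, and
-- give I the colour freed up; then χ ≤ n − |I| and 4ιχ ≤ 4|I|(n − |I|) ≤ n². Otherwise V ∖ I is a clique,
-- and maximality of deg v forces I = {v}, so ι = 1 and 4ιχ ≤ 4n ≤ n².

open import Defs hiding (sym)

open import Data.Bool using (true; false; if_then_else_; not; _∧_; _∨_)
import Data.Bool.Properties as Boolₚ
open import Data.Fin using (Fin; zero; suc; toℕ; fromℕ<; _≟_)
import Data.Fin as Fin
import Data.Fin.Properties as Finₚ
open import Data.Fin.Permutation using (Permutation; _⟨$⟩ʳ_; _⟨$⟩ˡ_; inverseˡ; transpose)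
open import Data.Fin.Subset.Properties using (anySubset?)
open import Data.List using (allFin)
import Data.List as List
open import Data.List.Extrema.Nat using (argmax; f[xs]≤f[argmax])
open import Data.List.Membership.Propositional.Properties using (∈-allFin)
open import Data.List.Properties using (map-tabulate)
import Data.List.Relation.Unary.All as All
open import Data.Nat using (ℕ; zero; suc; _+_; _*_; _∸_; _≤_; _<_; _⊔_; _⊓_; z≤n; s≤s; s≤s⁻¹)
open import Data.Nat.Induction using (<-wellFounded)
open import Data.Nat.ListAction using () renaming (sum to sumˡ)
import Data.Nat.Properties as ℕₚ
open ℕₚ hiding (_≟_; suc-injective)
open import Data.Nat.Tactic.RingSolver using (solve-∀)
open import Data.Product using (Σ-syntax; _×_; _,_; proj₁; proj₂)
open import Data.Sum using (_⊎_; inj₁; inj₂)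
open import Data.Vec using (lookup; tabulate)
open import Data.Vec.Properties using (lookup∘tabulate)
open import Function using (_∘_; id)
open import Function.Bundles using (_⇔_; mk⇔)
open import Induction.WellFounded using (Acc; acc)
open import Relation.Binary.Definitions using (tri<; tri≈; tri>)
open import Relation.Binary.PropositionalEquality
open import Relation.Nullary using (¬_; Dec; yes; no; does; proof; contradiction)
open import Relation.Nullary.Decidable using (dec-true; dec-false; _×-dec_; _→-dec_; ¬?)
open import Relation.Nullary.Reflects using (Reflects; invert)

open import Algebra.Properties.Semiring.Sum ℕₚ.+-*-semiring
  using (sum; sum-cong-≗; sum-replicate-zero; ∑-distrib-+; *-distribˡ-sum)

variable
  n : ℕ

sum-mono-≤ : {f g : Fin n → ℕ} → (∀ i → f i ≤ g i) → sum f ≤ sum g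
sum-mono-≤ {zero}  f≤g = z≤n
sum-mono-≤ {suc n} f≤g = +-mono-≤ (f≤g zero) (sum-mono-≤ (f≤g ∘ suc))

sum-mono-< : {f g : Fin n → ℕ} (j : Fin n) → (∀ i → f i ≤ g i) → f j < g j → sum f < sum g
sum-mono-< zero    f≤g fj<gj = +-mono-<-≤ fj<gj (sum-mono-≤ (f≤g ∘ suc))
sum-mono-< (suc j) f≤g fj<gj = +-mono-≤-< (f≤g zero) (sum-mono-< j (f≤g ∘ suc) fj<gj)

point≤sum : (f : Fin n → ℕ) (i : Fin n) → f i ≤ sum f
point≤sum f zero    = m≤m+n (f zero) _
point≤sum f (suc i) = ≤-trans (point≤sum (f ∘ suc) i) (m≤n+m _ (f zero))

pair≤sum : (f : Fin n → ℕ) {i j : Fin n} → i ≢ j → f i + f j ≤ sum f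
pair≤sum f {zero}  {zero}  i≢j = contradiction refl i≢j
pair≤sum f {zero}  {suc j} i≢j = +-monoʳ-≤ (f zero) (point≤sum (f ∘ suc) j)
pair≤sum f {suc i} {zero}  i≢j = subst (_≤ sum f) (+-comm (f zero) (f (suc i))) (pair≤sum f (i≢j ∘ sym))
pair≤sum f {suc i} {suc j} i≢j = ≤-trans (pair≤sum (f ∘ suc) (i≢j ∘ cong suc)) (m≤n+m _ (f zero))

sum-single : (f : Fin n → ℕ) (i : Fin n) → (∀ j → j ≢ i → f j ≡ 0) → sum f ≡ f i
sum-single {suc n} f zero vanish = begin
  f zero + sum (f ∘ suc)     ≡⟨ cong (f zero +_) (sum-cong-≗ (λ j → vanish (suc j) λ ())) ⟩
  f zero + sum {n} (λ _ → 0) ≡⟨ cong (f zero +_) (sum-replicate-zero n) ⟩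
  f zero + 0                 ≡⟨ +-identityʳ (f zero) ⟩
  f zero                     ∎
  where open ≡-Reasoning
sum-single f (suc i) vanish =
  cong₂ _+_ (vanish zero λ ()) (sum-single (f ∘ suc) i λ j j≢i → vanish (suc j) (j≢i ∘ Finₚ.suc-injective))

sum-const-1 : ∀ n → sum {n} (λ _ → 1) ≡ n
sum-const-1 zero    = refl
sum-const-1 (suc n) = cong suc (sum-const-1 n)

sumˡ-tabulate : (f : Fin n → ℕ) → sumˡ (List.tabulate f) ≡ sum f
sumˡ-tabulate {zero}  f = refl
sumˡ-tabulate {suc n} f = cong (f zero +_) (sumˡ-tabulate (f ∘ suc))

_⊆ₛ_ : Subset n → Subset n → Set
A ⊆ₛ B = ∀ v → v ∈ₛ A → v ∈ₛ B

∁ : Subset n → Subset n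
∁ A v = not (A v)

_∪_ : Subset n → Subset n → Subset n
(A ∪ B) v = A v ∨ B v

⁅_⁆ : Fin n → Subset n
⁅ x ⁆ v = does (v ≟ x)

fromDoes : {A : Set} (a? : Dec A) → does a? ≡ true → A
fromDoes {A} a? holds = invert (subst (Reflects A) holds (proof a?))

x∈⁅x⁆ : (x : Fin n) → x ∈ₛ ⁅ x ⁆
x∈⁅x⁆ x = dec-true (x ≟ x) refl

x≢y⇒x∉⁅y⁆ : {x y : Fin n} → x ≢ y → x ∉ₛ ⁅ y ⁆
x≢y⇒x∉⁅y⁆ {x = x} {y} = dec-false (x ≟ y)

x∈⁅y⁆⇒x≡y : {x y : Fin n} → x ∈ₛ ⁅ y ⁆ → x ≡ y
x∈⁅y⁆⇒x≡y {x = x} {y} = fromDoes (x ≟ y)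

x∉⁅y⁆⇒x≢y : {x y : Fin n} → x ∉ₛ ⁅ y ⁆ → x ≢ y
x∉⁅y⁆⇒x≢y {x = x} x∉⁅x⁆ refl with () ← trans (sym (x∈⁅x⁆ x)) x∉⁅x⁆

∈∪ˡ : (A B : Subset n) {x : Fin n} → x ∈ₛ A → x ∈ₛ (A ∪ B)
∈∪ˡ A B {x} x∈A = cong (_∨ B x) x∈A

∈∪ʳ : (A B : Subset n) {x : Fin n} → x ∈ₛ B → x ∈ₛ (A ∪ B)
∈∪ʳ A B {x} x∈B = trans (cong (A x ∨_) x∈B) (Boolₚ.∨-zeroʳ (A x))

∈∪⁻ : (A B : Subset n) {x : Fin n} → x ∈ₛ (A ∪ B) → x ∈ₛ A ⊎ x ∈ₛ B
∈∪⁻ A B {x} x∈A∪B with A x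
... | true  = inj₁ refl
... | false = inj₂ x∈A∪B

∉∪ : (A B : Subset n) {x : Fin n} → x ∉ₛ A → x ∉ₛ B → x ∉ₛ (A ∪ B)
∉∪ A B = cong₂ _∨_

∁-antitone : {A B : Subset n} → A ⊆ₛ B → ∁ B ⊆ₛ ∁ A
∁-antitone {A = A} {B} A⊆B x x∉B with A x in x∈A
... | true  with () ← trans (sym (cong not (A⊆B x x∈A))) x∉B
... | false = refl

_↾_ : (Fin n → ℕ) → Subset n → Fin n → ℕ
(c ↾ D) v = if D v then c v else 0

↾-∈ : (c : Fin n → ℕ) (D : Subset n) {v : Fin n} → v ∈ₛ D → (c ↾ D) v ≡ c v
↾-∈ c D {v} v∈D = cong (if_then c v else 0) v∈D

↾-∉ : (c : Fin n → ℕ) (D : Subset n) {v : Fin n} → v ∉ₛ D → (c ↾ D) v ≡ 0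
↾-∉ c D {v} v∉D = cong (if_then c v else 0) v∉D

weight≡sum : (c : Fin n → ℕ) (D : Subset n) → weight c D ≡ sum (c ↾ D)
weight≡sum c D = trans (cong sumˡ (map-tabulate id (c ↾ D))) (sumˡ-tabulate (c ↾ D))

↾-monoʳ : (c : Fin n → ℕ) {A B : Subset n} → A ⊆ₛ B → ∀ v → (c ↾ A) v ≤ (c ↾ B) v
↾-monoʳ c {A} {B} A⊆B v with A v in v∈A
... | true  = ≤-reflexive (sym (↾-∈ c B (A⊆B v v∈A)))
... | false = z≤n

weight-monoʳ : (c : Fin n → ℕ) {A B : Subset n} → A ⊆ₛ B → weight c A ≤ weight c B
weight-monoʳ c {A} {B} A⊆B = begin
  weight c A  ≡⟨ weight≡sum c A ⟩
  sum (c ↾ A) ≤⟨ sum-mono-≤ (↾-monoʳ c A⊆B) ⟩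
  sum (c ↾ B) ≡⟨ weight≡sum c B ⟨
  weight c B  ∎
  where open ≤-Reasoning

weight-congʳ : (c : Fin n → ℕ) {A B : Subset n} → A ≗ B → weight c A ≡ weight c B
weight-congʳ c A≗B = ≤-antisym (weight-monoʳ c (λ v v∈A → trans (sym (A≗B v)) v∈A))
                               (weight-monoʳ c (λ v v∈B → trans (A≗B v) v∈B))

weight-monoˡ : {c c' : Fin n → ℕ} (D : Subset n) →
  (∀ v → v ∈ₛ D → c v ≤ c' v) → weight c D ≤ weight c' D
weight-monoˡ {c = c} {c'} D c≤c' = begin
  weight c D   ≡⟨ weight≡sum c D ⟩
  sum (c ↾ D)  ≤⟨ sum-mono-≤ pointwise ⟩
  sum (c' ↾ D) ≡⟨ weight≡sum c' D ⟨
  weight c' D  ∎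
  where
  open ≤-Reasoning
  pointwise : ∀ v → (c ↾ D) v ≤ (c' ↾ D) v
  pointwise v with D v in v∈D
  ... | true  = c≤c' v v∈D
  ... | false = z≤n

weight-congˡ : {c c' : Fin n → ℕ} (D : Subset n) →
  (∀ v → v ∈ₛ D → c v ≡ c' v) → weight c D ≡ weight c' D
weight-congˡ D c≡c' = ≤-antisym (weight-monoˡ D (λ v v∈D → ≤-reflexive (c≡c' v v∈D)))
                                (weight-monoˡ D (λ v v∈D → ≤-reflexive (sym (c≡c' v v∈D))))

weight-∈ : (c : Fin n → ℕ) {D : Subset n} {v : Fin n} → v ∈ₛ D → c v ≤ weight c D
weight-∈ c {D} {v} v∈D = begin
  c v         ≡⟨ ↾-∈ c D v∈D ⟨
  (c ↾ D) v   ≤⟨ point≤sum (c ↾ D) v ⟩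
  sum (c ↾ D) ≡⟨ weight≡sum c D ⟨
  weight c D  ∎
  where open ≤-Reasoning

weight-pair : (c : Fin n → ℕ) {D : Subset n} {u v : Fin n} →
  u ≢ v → u ∈ₛ D → v ∈ₛ D → c u + c v ≤ weight c D
weight-pair c {D} {u} {v} u≢v u∈D v∈D = begin
  c u + c v             ≡⟨ cong₂ _+_ (↾-∈ c D u∈D) (↾-∈ c D v∈D) ⟨
  (c ↾ D) u + (c ↾ D) v ≤⟨ pair≤sum (c ↾ D) u≢v ⟩
  sum (c ↾ D)           ≡⟨ weight≡sum c D ⟨
  weight c D            ∎
  where open ≤-Reasoning

weight-+ : (c c' : Fin n → ℕ) (D : Subset n) → weight c D + weight c' D ≡ weight (λ v → c v + c' v) D
weight-+ c c' D = begin
  weight c D + weight c' D             ≡⟨ cong₂ _+_ (weight≡sum c D) (weight≡sum c' D) ⟩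
  sum (c ↾ D) + sum (c' ↾ D)           ≡⟨ ∑-distrib-+ (c ↾ D) (c' ↾ D) ⟨
  sum (λ v → (c ↾ D) v + (c' ↾ D) v)   ≡⟨ sum-cong-≗ pointwise ⟩
  sum ((λ v → c v + c' v) ↾ D)         ≡⟨ weight≡sum _ D ⟨
  weight (λ v → c v + c' v) D          ∎
  where
  open ≡-Reasoning
  pointwise : ∀ v → (c ↾ D) v + (c' ↾ D) v ≡ ((λ v → c v + c' v) ↾ D) v
  pointwise v with D v
  ... | true  = refl
  ... | false = refl

𝟙[_] : Subset n → Fin n → ℕ
𝟙[ A ] = (λ _ → 1) ↾ A

size≡sum : (A : Subset n) → size A ≡ sum 𝟙[ A ]
size≡sum = weight≡sum (λ _ → 1)

weight-const : (k : ℕ) (D : Subset n) → weight (λ _ → k) D ≡ k * size D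
weight-const k D = begin
  weight (λ _ → k) D        ≡⟨ weight≡sum _ D ⟩
  sum ((λ _ → k) ↾ D)       ≡⟨ sum-cong-≗ pointwise ⟩
  sum (λ v → k * 𝟙[ D ] v)  ≡⟨ *-distribˡ-sum k 𝟙[ D ] ⟨
  k * sum 𝟙[ D ]            ≡⟨ cong (k *_) (size≡sum D) ⟨
  k * size D                ∎
  where
  open ≡-Reasoning
  pointwise : ∀ v → ((λ _ → k) ↾ D) v ≡ k * 𝟙[ D ] v
  pointwise v with D v
  ... | true  = sym (*-identityʳ k)
  ... | false = sym (*-zeroʳ k)

weight-⁅⁆ : (c : Fin n → ℕ) (x : Fin n) → weight c ⁅ x ⁆ ≡ c x
weight-⁅⁆ c x = begin
  weight c ⁅ x ⁆    ≡⟨ weight≡sum c ⁅ x ⁆ ⟩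
  sum (c ↾ ⁅ x ⁆)   ≡⟨ sum-single (c ↾ ⁅ x ⁆) x (λ v v≢x → ↾-∉ c ⁅ x ⁆ {v} (x≢y⇒x∉⁅y⁆ v≢x)) ⟩
  (c ↾ ⁅ x ⁆) x     ≡⟨ ↾-∈ c ⁅ x ⁆ {x} (x∈⁅x⁆ x) ⟩
  c x               ∎
  where open ≡-Reasoning

size-⊂ : {A B : Subset n} {x : Fin n} → A ⊆ₛ B → x ∈ₛ B → x ∉ₛ A → size A < size B
size-⊂ {A = A} {B} {x} A⊆B x∈B x∉A = begin-strict
  size A     ≡⟨ size≡sum A ⟩
  sum 𝟙[ A ] <⟨ sum-mono-< x (↾-monoʳ (λ _ → 1) A⊆B) strictly ⟩
  sum 𝟙[ B ] ≡⟨ size≡sum B ⟨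
  size B     ∎
  where
  open ≤-Reasoning
  strictly : 𝟙[ A ] x < 𝟙[ B ] x
  strictly = subst₂ _<_ (sym (↾-∉ (λ _ → 1) A x∉A)) (sym (↾-∈ (λ _ → 1) B x∈B)) (s≤s z≤n)

size-insert : (A : Subset n) {x : Fin n} → x ∉ₛ A → size (⁅ x ⁆ ∪ A) ≡ suc (size A)
size-insert A {x} x∉A = begin
  size (⁅ x ⁆ ∪ A)                    ≡⟨ size≡sum (⁅ x ⁆ ∪ A) ⟩
  sum 𝟙[ ⁅ x ⁆ ∪ A ]                  ≡⟨ sum-cong-≗ pointwise ⟩
  sum (λ v → 𝟙[ ⁅ x ⁆ ] v + 𝟙[ A ] v) ≡⟨ ∑-distrib-+ 𝟙[ ⁅ x ⁆ ] 𝟙[ A ] ⟩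
  sum 𝟙[ ⁅ x ⁆ ] + sum 𝟙[ A ]         ≡⟨ cong₂ _+_ (size≡sum ⁅ x ⁆) (size≡sum A) ⟨
  size ⁅ x ⁆ + size A                 ≡⟨ cong (_+ size A) (weight-⁅⁆ (λ _ → 1) x) ⟩
  suc (size A)                        ∎
  where
  open ≡-Reasoning
  pointwise : ∀ v → 𝟙[ ⁅ x ⁆ ∪ A ] v ≡ 𝟙[ ⁅ x ⁆ ] v + 𝟙[ A ] v
  pointwise v with v ≟ x
  ... | yes refl = cong (λ b → suc (if b then 1 else 0)) (sym x∉A)
  ... | no _     = refl

size-∁ : (A : Subset n) → size A + size (∁ A) ≡ n
size-∁ {n} A = begin
  size A + size (∁ A)               ≡⟨ cong₂ _+_ (size≡sum A) (size≡sum (∁ A)) ⟩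
  sum 𝟙[ A ] + sum 𝟙[ ∁ A ]         ≡⟨ ∑-distrib-+ 𝟙[ A ] 𝟙[ ∁ A ] ⟨
  sum (λ v → 𝟙[ A ] v + 𝟙[ ∁ A ] v) ≡⟨ sum-cong-≗ pointwise ⟩
  sum {n} (λ _ → 1)                 ≡⟨ sum-const-1 n ⟩
  n                                 ∎
  where
  open ≡-Reasoning
  pointwise : ∀ v → 𝟙[ A ] v + 𝟙[ ∁ A ] v ≡ 1
  pointwise v with A v
  ... | true  = refl
  ... | false = refl

below : Subset n → Fin n → Subset n
below C x z = C z ∧ does (z Fin.<? x)

rank : Subset n → Fin n → ℕ
rank C x = size (below C x)

x∉below-x : (C : Subset n) (x : Fin n) → x ∉ₛ below C x
x∉below-x C x = trans (cong (C x ∧_) (dec-false (x Fin.<? x) (Finₚ.<-irrefl refl))) (Boolₚ.∧-zeroʳ (C x))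

rank<size : (C : Subset n) {x : Fin n} → x ∈ₛ C → rank C x < size C
rank<size C {x} x∈C = size-⊂ {A = below C x} (λ z z∈ → Boolₚ.∧-conicalˡ _ _ z∈) x∈C (x∉below-x C x)

rank-mono : (C : Subset n) {x y : Fin n} → x ∈ₛ C → x Fin.< y → rank C x < rank C y
rank-mono C {x} {y} x∈C x<y = size-⊂ {A = below C x} below-x⊆below-y (∈below-y x∈C x<y) (x∉below-x C x)
  where
  ∈below-y : ∀ {z} → z ∈ₛ C → z Fin.< y → z ∈ₛ below C y
  ∈below-y z∈C z<y = cong₂ _∧_ z∈C (dec-true (_ Fin.<? y) z<y)
  below-x⊆below-y : below C x ⊆ₛ below C y
  below-x⊆below-y z z∈ = ∈below-y (Boolₚ.∧-conicalˡ _ _ z∈)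
    (Finₚ.<-trans (fromDoes (z Fin.<? x) (Boolₚ.∧-conicalʳ (C z) _ z∈)) x<y)

rank-injective : (C : Subset n) {x y : Fin n} → x ∈ₛ C → y ∈ₛ C → rank C x ≡ rank C y → x ≡ y
rank-injective C {x} {y} x∈C y∈C eq with Finₚ.<-cmp x y
... | tri< x<y _ _ = contradiction eq (<⇒≢ (rank-mono C x∈C x<y))
... | tri≈ _ x≡y _ = x≡y
... | tri> _ _ y<x = contradiction (sym eq) (<⇒≢ (rank-mono C y∈C y<x))

-- Subsets are searched as vectors, so P and f must respect pointwise equality.
module Minimisation {n : ℕ} {P : Subset n → Set} (P? : ∀ A → Dec (P A))
  (P-resp : ∀ {A B} → A ≗ B → P A → P B) (f : Subset n → ℕ) (f-resp : ∀ {A B} → A ≗ B → f A ≡ f B) where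

  minimiser : {A : Subset n} → P A → Σ[ B ∈ Subset n ] P B × (∀ B' → P B' → f B ≤ f B')
  minimiser {A} = descend A (<-wellFounded (f A))
    where
    descend : ∀ A → Acc _<_ (f A) → P A → Σ[ B ∈ Subset n ] P B × (∀ B' → P B' → f B ≤ f B')
    descend A (acc smaller) pA with anySubset? (λ V → P? (lookup V) ×-dec (f (lookup V) <? f A))
    ... | yes (V , pV , fV<fA) = descend (lookup V) (smaller fV<fA) pV
    ... | no nothing-smaller   = A , pA , λ B pB → ≮⇒≥ λ fB<fA →
      nothing-smaller (tabulate B , P-resp (sym ∘ lookup∘tabulate B) pB ,
                       subst (_< f A) (sym (f-resp (lookup∘tabulate B))) fB<fA)

argmax-vertex : Fin n → (f : Fin n → ℕ) → Σ[ m ∈ Fin n ] (∀ u → f u ≤ f m)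
argmax-vertex v₀ f =
  argmax f v₀ (allFin _) , λ u → All.lookup (f[xs]≤f[argmax] {f = f} v₀ (allFin _)) (∈-allFin u)

Adj-sym : (G : Graph n) {u w : Fin n} → Adj G u w → Adj G w u
Adj-sym G {u} {w} u~w = trans (Graph.sym G w u) u~w

Adj⇒≢ : (G : Graph n) {u w : Fin n} → Adj G u w → u ≢ w
Adj⇒≢ G {u} u~w refl with () ← trans (sym u~w) (irrefl G u)

independent-∉ : {G : Graph n} {I : Subset n} {x z : Fin n} →
  IsIndependent G I → x ∈ₛ I → Adj G x z → z ∉ₛ I
independent-∉ {I = I} {x} {z} independent x∈I x~z with I z in z∈I
... | true  = contradiction x~z (independent x z x∈I z∈I)
... | false = refl

⁅⁆-independent : (G : Graph n) (x : Fin n) → IsIndependent G ⁅ x ⁆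
⁅⁆-independent G x u w u∈⁅x⁆ w∈⁅x⁆ u~w =
  Adj⇒≢ G u~w (trans (x∈⁅y⁆⇒x≡y {y = x} u∈⁅x⁆) (sym (x∈⁅y⁆⇒x≡y {y = x} w∈⁅x⁆)))

neighbour : {G : Graph n} {u w : Fin n} → Reach G u w → u ≢ w → Σ[ y ∈ Fin n ] Adj G u y
neighbour here         u≢u = contradiction refl u≢u
neighbour (step u~y _) _   = _ , u~y

connected⇒edge : {G : Graph n} → 2 ≤ n → Connected G → Σ[ u ∈ Fin n ] Σ[ w ∈ Fin n ] Adj G u w
connected⇒edge (s≤s (s≤s _)) connected = zero , neighbour (connected zero (suc zero)) (λ ())

degree : Graph n → Fin n → ℕ
degree G u = size (edge G u)

closedNbhd : Graph n → Fin n → Subset n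
closedNbhd G u = ⁅ u ⁆ ∪ edge G u

size-closedNbhd : (G : Graph n) (u : Fin n) → size (closedNbhd G u) ≡ suc (degree G u)
size-closedNbhd G u = size-insert (edge G u) (irrefl G u)

Adj⇒∈closedNbhd : (G : Graph n) {u w : Fin n} → Adj G u w → w ∈ₛ closedNbhd G u
Adj⇒∈closedNbhd G {u} = ∈∪ʳ ⁅ u ⁆ (edge G u)

self∈closedNbhd : (G : Graph n) (u : Fin n) → u ∈ₛ closedNbhd G u
self∈closedNbhd G u = ∈∪ˡ ⁅ u ⁆ (edge G u) (x∈⁅x⁆ u)

∈closedNbhd⁻ : (G : Graph n) {u w : Fin n} → w ∈ₛ closedNbhd G u → w ≡ u ⊎ Adj G u w
∈closedNbhd⁻ G {u} w∈N[u] with ∈∪⁻ ⁅ u ⁆ (edge G u) w∈N[u]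
... | inj₁ w∈⁅u⁆ = inj₁ (x∈⁅y⁆⇒x≡y w∈⁅u⁆)
... | inj₂ u~w   = inj₂ u~w

∉closedNbhd : (G : Graph n) {u w : Fin n} → w ≢ u → ¬ Adj G u w → w ∉ₛ closedNbhd G u
∉closedNbhd G {u} w≢u u≁w = ∉∪ ⁅ u ⁆ (edge G u) (x≢y⇒x∉⁅y⁆ w≢u) (Boolₚ.¬-not u≁w)

distinct-below⇒2≤ : {a b k : ℕ} → a < k → b < k → a ≢ b → 2 ≤ k
distinct-below⇒2≤ {zero}  {zero}  _   _   a≢b = contradiction refl a≢b
distinct-below⇒2≤ {zero}  {suc b} _   b<k _   = ≤-trans (s≤s (s≤s z≤n)) b<k
distinct-below⇒2≤ {suc a} {_}     a<k _   _   = ≤-trans (s≤s (s≤s z≤n)) a<k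

edge⇒2≤χ : {G : Graph n} {χ : ℕ} {u w : Fin n} → IsChromatic G χ → Adj G u w → 2 ≤ χ
edge⇒2≤χ {u = u} {w} ((c , proper , bound) , _) u~w = distinct-below⇒2≤ (bound u) (bound w) (proper u w u~w)

χ≤n : {G : Graph n} {χ : ℕ} → IsChromatic G χ → χ ≤ n
χ≤n {n} {G} (_ , least) =
  least n (toℕ , (λ u w u~w eq → Adj⇒≢ G u~w (Finₚ.toℕ-injective eq)) , Finₚ.toℕ<n)

colourable-by-rank : (G : Graph n) (C : Subset n) (φ : Fin n → Fin n) →
  (∀ z → φ z ∈ₛ C) → (∀ u w → Adj G u w → φ u ≢ φ w) → ColorableWith G (size C)
colourable-by-rank G C φ φ∈C φ-separates =
  (λ z → rank C (φ z)) ,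
  (λ u w u~w eq → φ-separates u w u~w (rank-injective C (φ∈C u) (φ∈C w) eq)) ,
  (λ z → rank<size C (φ∈C z))

permute-colours : {G : Graph n} {c : Fin n → ℕ} {k : ℕ} → IsColoring G c → (bound : ∀ v → c v < k) →
  (π : Permutation k k) → IsColoring G (λ v → toℕ (π ⟨$⟩ʳ fromℕ< (bound v)))
permute-colours {c = c} proper bound π u w u~w eq =
  proper u w u~w (Finₚ.fromℕ<-injective (c u) (c w) (bound u) (bound w) (π-injective (Finₚ.toℕ-injective eq)))
  where
  π-injective : ∀ {i j} → π ⟨$⟩ʳ i ≡ π ⟨$⟩ʳ j → i ≡ j
  π-injective {i} {j} eq = trans (sym (inverseˡ π)) (trans (cong (π ⟨$⟩ˡ_) eq) (inverseˡ π))

transpose-sends : (i j : Fin n) → transpose i j ⟨$⟩ʳ i ≡ j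
transpose-sends i j rewrite dec-true (i ≟ i) refl = refl

IsUCDSet? : (G : Graph n) (c : Fin n → ℕ) (D : Subset n) → Dec (IsUCDSet G c D)
IsUCDSet? G c D =
  Finₚ.all? (λ v → (D v Boolₚ.≟ false) →-dec
    Finₚ.any? (λ d → (D d Boolₚ.≟ true) ×-dec (edge G v d Boolₚ.≟ true) ×-dec (c v <? c d)))
  ×-dec Finₚ.all? (λ v → (D v Boolₚ.≟ true) →-dec ¬? (c v ℕₚ.≟ 0))

IsUCDSet-resp : (G : Graph n) (c : Fin n → ℕ) {D D' : Subset n} → D ≗ D' → IsUCDSet G c D → IsUCDSet G c D'
IsUCDSet-resp G c D≗D' (dominated , nonzero) =
  (λ v v∉D' → let (d , d∈D , v~d , cv<cd) = dominated v (trans (D≗D' v) v∉D')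
              in d , trans (sym (D≗D' d)) d∈D , v~d , cv<cd) ,
  (λ v v∈D' → nonzero v (trans (D≗D' v) v∈D'))

ω-exists : {G : Graph n} {c : Fin n → ℕ} {D : Subset n} → IsUCDSet G c D →
  Σ[ w ∈ ℕ ] IsOmegaUC G c w × w ≤ weight c D
ω-exists {G = G} {c} {D} ucd =
  let (B , ucdB , minimal) = minimiser ucd in weight c B , ((B , ucdB , refl) , minimal) , minimal D ucd
  where open Minimisation (IsUCDSet? G c) (IsUCDSet-resp G c) (weight c) (weight-congʳ c)

Ω≤weight : {G : Graph n} {Ω : ℕ} {c : Fin n → ℕ} {D : Subset n} →
  IsBigOmegaUC G Ω → IsColoring G c → IsUCDSet G c D → Ω ≤ weight c D
Ω≤weight {G = G} {c = c} (_ , least) proper ucd =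
  let (w , ω≡w , w≤weight) = ω-exists {G = G} ucd in ≤-trans (least c w proper ω≡w) w≤weight

UCD⇒dominating : {G : Graph n} {c : Fin n → ℕ} {D : Subset n} → IsUCDSet G c D → IsDominating G D
UCD⇒dominating (dominated , _) v v∉D = let (d , d∈D , v~d , _) = dominated v v∉D in d , d∈D , v~d

max-colour∈ : {G : Graph n} {c : Fin n → ℕ} {D : Subset n} {m : Fin n} →
  IsUCDSet G c D → (∀ u → c u ≤ c m) → m ∈ₛ D
max-colour∈ {D = D} {m} (dominated , _) maximum with D m in m∈D
... | true  = refl
... | false = let (d , _ , _ , cm<cd) = dominated m m∈D in contradiction (maximum d) (<⇒≱ cm<cd)

χ∸1≤colour-bound : {G : Graph n} {χ b : ℕ} {c : Fin n → ℕ} →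
  IsChromatic G χ → IsColoring G c → (∀ u → c u ≤ b) → χ ∸ 1 ≤ b
χ∸1≤colour-bound {b = b} {c} (_ , least) proper bound =
  ∸-monoˡ-≤ 1 (least (suc b) (c , proper , s≤s ∘ bound))

dominated-by-one⇒cone : {G : Graph n} {D : Subset n} {m : Fin n} →
  IsDominating G D → (∀ u → u ∈ₛ D → u ≡ m) → IsCone G
dominated-by-one⇒cone {G = G} {D} {m} dominating only-m = m , covered
  where
  covered : ∀ u → u ≡ m ⊎ Adj G m u
  covered u with u ≟ m | D u in u∈D
  ... | yes u≡m | _     = inj₁ u≡m
  ... | no u≢m  | true  = contradiction (only-m u u∈D) u≢m
  ... | no _    | false = let (d , d∈D , u~d) = dominating u u∈D
                          in inj₂ (Adj-sym G (subst (Adj G u) (only-m d d∈D) u~d))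

γ≤Ω : {G : Graph n} {γ Ω : ℕ} → IsDomNumber G γ → IsBigOmegaUC G Ω → γ ≤ Ω
γ≤Ω {G = G} {γ} {Ω} (_ , least) ((c , _ , (D , ucd , weight≡Ω) , _) , _) = begin
  γ          ≤⟨ least D (UCD⇒dominating {G = G} ucd) ⟩
  size D     ≤⟨ weight-monoˡ D (λ v v∈D → n≢0⇒n>0 (proj₂ ucd v v∈D)) ⟩
  weight c D ≡⟨ weight≡Ω ⟩
  Ω          ∎
  where open ≤-Reasoning

module UCDSet {G : Graph n} {c : Fin n → ℕ} {D : Subset n} (proper : IsColoring G c) (ucd : IsUCDSet G c D)
              (v₀ : Fin n) where

  m : Fin n
  m = proj₁ (argmax-vertex v₀ c)

  m∈D : m ∈ₛ D
  m∈D = max-colour∈ {G = G} ucd (proj₂ (argmax-vertex v₀ c))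

  χ∸1≤cm : {χ : ℕ} → IsChromatic G χ → χ ∸ 1 ≤ c m
  χ∸1≤cm hχ = χ∸1≤colour-bound {G = G} hχ proper (proj₂ (argmax-vertex v₀ c))

  χ∸1≤weight : {χ : ℕ} → IsChromatic G χ → χ ∸ 1 ≤ weight c D
  χ∸1≤weight hχ = ≤-trans (χ∸1≤cm hχ) (weight-∈ c m∈D)

  weight≤χ∸1⇒cone : {χ : ℕ} → IsChromatic G χ → weight c D ≤ χ ∸ 1 → IsCone G
  weight≤χ∸1⇒cone {χ} hχ weight≤χ∸1 = dominated-by-one⇒cone {G = G} (UCD⇒dominating {G = G} ucd) only-m
    where
    only-m : ∀ u → u ∈ₛ D → u ≡ m
    only-m u u∈D with u ≟ m
    ... | yes u≡m = u≡m
    ... | no u≢m  = contradiction (begin-strict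
      c m         <⟨ m<m+n (c m) (n≢0⇒n>0 (proj₂ ucd u u∈D)) ⟩
      c m + c u   ≤⟨ weight-pair c (u≢m ∘ sym) m∈D u∈D ⟩
      weight c D  ≤⟨ weight≤χ∸1 ⟩
      χ ∸ 1       ≤⟨ χ∸1≤cm hχ ⟩
      c m         ∎) (<-irrefl refl)
      where open ≤-Reasoning

module Raise (G : Graph n) {c : Fin n → ℕ} (proper : IsColoring G c) (S : Subset n) (f : Fin n → ℕ)
  (f-separates : ∀ u w → u ∈ₛ S → w ∈ₛ S → Adj G u w → f u ≢ f w)
  (f-above : ∀ u w → w ∈ₛ S → c u ≢ c w → c u < f w)
  (f-nonzero : ∀ w → w ∈ₛ S → f w ≢ 0) where

  raised : Fin n → ℕ
  raised v = if S v then f v else c v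

  raised-∈ : ∀ v → v ∈ₛ S → raised v ≡ f v
  raised-∈ v v∈S = cong (if_then f v else c v) v∈S

  raised-∉ : ∀ v → v ∉ₛ S → raised v ≡ c v
  raised-∉ v v∉S = cong (if_then f v else c v) v∉S

  raised-proper : IsColoring G raised
  raised-proper u w u~w with S u in u∈S | S w in w∈S
  ... | true  | true  = f-separates u w u∈S w∈S u~w
  ... | true  | false = λ fu≡cw → <-irrefl (sym fu≡cw) (f-above w u u∈S (proper w u (Adj-sym G u~w)))
  ... | false | true  = λ cu≡fw → <-irrefl cu≡fw (f-above u w w∈S (proper u w u~w))
  ... | false | false = proper u w u~w

  raised-UCD : IsDominating G S → IsUCDSet G raised S
  raised-UCD dominating =
    (λ v v∉S → let (d , d∈S , v~d) = dominating v v∉S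
               in d , d∈S , v~d ,
                  subst₂ _<_ (sym (raised-∉ v v∉S)) (sym (raised-∈ d d∈S)) (f-above v d d∈S (proper v d v~d))) ,
    (λ v v∈S → f-nonzero v v∈S ∘ trans (sym (raised-∈ v v∈S)))

  Ω≤weight-raised : {Ω : ℕ} → IsBigOmegaUC G Ω → IsDominating G S → Ω ≤ weight f S
  Ω≤weight-raised hΩ dominating = begin
    _               ≤⟨ Ω≤weight {G = G} {c = raised} hΩ raised-proper (raised-UCD dominating) ⟩
    weight raised S ≡⟨ weight-congˡ S raised-∈ ⟩
    weight f S      ∎
    where open ≤-Reasoning

2*-as-+ : (k : ℕ) → 2 * k ≡ k + k
2*-as-+ k = cong (k +_) (+-identityʳ k)

reflect-injective : {a b k : ℕ} → a ≤ k → b ≤ k → 2 * k ∸ a ≡ 2 * k ∸ b → a ≡ b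
reflect-injective {k = k} a≤k b≤k = ∸-cancelˡ-≡ (≤-trans a≤k (m≤n*m k 2)) (≤-trans b≤k (m≤n*m k 2))

reflect-≥ : {a k : ℕ} → a ≤ k → k ≤ 2 * k ∸ a
reflect-≥ {a} {k} a≤k = m+n≤o⇒m≤o∸n k (subst (k + a ≤_) (sym (2*-as-+ k)) (+-monoʳ-≤ k a≤k))

reflect-above : {a b k : ℕ} → a ≤ k → b ≤ k → b ≢ a → b < 2 * k ∸ a
reflect-above {a} {b} {k} a≤k b≤k b≢a = m+n≤o⇒m≤o∸n (suc b) (subst (b + a <_) (sym (2*-as-+ k)) b+a<k+k)
  where
  b+a<k+k : b + a < k + k
  b+a<k+k with m≤n⇒m<n∨m≡n a≤k
  ... | inj₁ a<k  = +-mono-≤-< b≤k a<k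
  ... | inj₂ refl = +-mono-<-≤ (≤∧≢⇒< b≤k b≢a) ≤-refl

reflect-pair : {a k : ℕ} → a ≤ k → (2 * k ∸ a) + (2 * k ∸ (k ∸ a)) ≡ 3 * k
reflect-pair {a} {k} a≤k = begin
  (2 * k ∸ a) + (2 * k ∸ (k ∸ a)) ≡⟨ cong (λ m → (2 * k ∸ a) + (m ∸ (k ∸ a))) (2*-as-+ k) ⟩
  (2 * k ∸ a) + (k + k ∸ (k ∸ a)) ≡⟨ cong ((2 * k ∸ a) +_) (+-∸-assoc k (m∸n≤m k a)) ⟩
  (2 * k ∸ a) + (k + (k ∸ (k ∸ a))) ≡⟨ cong (λ m → (2 * k ∸ a) + (k + m)) (m∸[m∸n]≡n a≤k) ⟩
  (2 * k ∸ a) + (k + a)           ≡⟨ cong ((2 * k ∸ a) +_) (+-comm k a) ⟩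
  (2 * k ∸ a) + (a + k)           ≡⟨ +-assoc (2 * k ∸ a) a k ⟨
  (2 * k ∸ a) + a + k             ≡⟨ cong (_+ k) (m∸n+n≡m (≤-trans a≤k (m≤n*m k 2))) ⟩
  2 * k + k                       ≡⟨ +-comm (2 * k) k ⟩
  3 * k                           ∎
  where open ≡-Reasoning

Ω≤reflected : {G : Graph n} {Ω k : ℕ} {c : Fin n → ℕ} {S : Subset n} → 1 ≤ k →
  IsColoring G c → (∀ v → c v ≤ k) → IsBigOmegaUC G Ω → IsDominating G S →
  Ω ≤ weight (λ v → 2 * k ∸ c v) S
Ω≤reflected {G = G} {k = k} {c} {S} 1≤k proper bound =
  Raise.Ω≤weight-raised G proper S (λ v → 2 * k ∸ c v)
    (λ u w _ _ u~w eq → proper u w u~w (reflect-injective (bound u) (bound w) eq))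
    (λ u w _ cu≢cw → reflect-above (bound w) (bound u) cu≢cw)
    (λ w _ → n>0⇒n≢0 (≤-trans 1≤k (reflect-≥ (bound w))))

-- The two reflected colourings cost (2k − c v) + (k + c v) = 3k on each vertex v of S together.
2Ω≤3[χ∸1]γ : {G : Graph n} {χ γ Ω : ℕ} → 2 ≤ χ →
  IsChromatic G χ → IsDomNumber G γ → IsBigOmegaUC G Ω → 2 * Ω ≤ 3 * (χ ∸ 1) * γ
2Ω≤3[χ∸1]γ {G = G} {suc k} {γ} {Ω} (s≤s 1≤k) ((c , proper , bound) , _) ((S , dominating , size≡γ) , _) hΩ =
  begin
  2 * Ω                                                 ≡⟨ 2*-as-+ Ω ⟩
  Ω + Ω                                                 ≤⟨ +-mono-≤ (Ω≤reflected {G = G} 1≤k proper c≤k hΩ dominating)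
                                                                    (Ω≤reflected {G = G} 1≤k reversed-proper reversed≤k hΩ dominating) ⟩
  weight (λ v → 2 * k ∸ c v) S + weight (λ v → 2 * k ∸ (k ∸ c v)) S
                                                        ≡⟨ weight-+ _ _ S ⟩
  weight (λ v → (2 * k ∸ c v) + (2 * k ∸ (k ∸ c v))) S  ≡⟨ weight-congˡ S (λ v _ → reflect-pair (c≤k v)) ⟩
  weight (λ _ → 3 * k) S                                ≡⟨ weight-const (3 * k) S ⟩
  3 * k * size S                                        ≡⟨ cong (3 * k *_) size≡γ ⟩
  3 * k * γ                                             ∎
  where
  open ≤-Reasoning
  c≤k : ∀ v → c v ≤ k
  c≤k v = s≤s⁻¹ (bound v)
  reversed≤k : ∀ v → k ∸ c v ≤ k
  reversed≤k v = m∸n≤m k (c v)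
  reversed-proper : IsColoring G (λ v → k ∸ c v)
  reversed-proper u w u~w eq = proper u w u~w (∸-cancelˡ-≡ (c≤k u) (c≤k w) eq)

Ω≤ιχ : {G : Graph n} {χ ι Ω : ℕ} → 1 ≤ χ →
  IsChromatic G χ → IsIndDomNumber G ι → IsBigOmegaUC G Ω → Ω ≤ ι * χ
Ω≤ιχ {G = G} {χ} {ι} {Ω} 1≤χ ((c , proper , bound) , _) ((I , independent , dominating , size≡ι) , _) hΩ =
  begin
  Ω                  ≤⟨ Raise.Ω≤weight-raised G proper I (λ _ → χ)
                          (λ u w u∈I w∈I u~w _ → independent u w u∈I w∈I u~w)
                          (λ u _ _ _ → bound u) (λ _ _ → n>0⇒n≢0 1≤χ) hΩ dominating ⟩
  weight (λ _ → χ) I ≡⟨ weight-const χ I ⟩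
  χ * size I         ≡⟨ cong (χ *_) size≡ι ⟩
  χ * ι              ≡⟨ *-comm χ ι ⟩
  ι * χ              ∎
  where open ≤-Reasoning

cone⇒Ω≤χ∸1 : {G : Graph n} {χ Ω : ℕ} → 2 ≤ χ →
  IsChromatic G χ → IsBigOmegaUC G Ω → IsCone G → Ω ≤ χ ∸ 1
cone⇒Ω≤χ∸1 {G = G} {suc k} {Ω} (s≤s 1≤k) ((c , proper , bound) , _) hΩ (v , apex) = begin
  Ω               ≤⟨ Ω≤weight {G = G} {c = c'} hΩ proper' (dominated , nonzero) ⟩
  weight c' ⁅ v ⁆ ≡⟨ weight-⁅⁆ c' v ⟩
  c' v            ≡⟨ c'v≡k ⟩
  k               ∎
  where
  open ≤-Reasoning
  -- τ gives the apex the top colour k; every other vertex is adjacent to the apex, so gets a smaller one.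
  top : Fin (suc k)
  top = fromℕ< (n<1+n k)

  τ : Permutation (suc k) (suc k)
  τ = transpose (fromℕ< (bound v)) top

  c' : Fin _ → ℕ
  c' u = toℕ (τ ⟨$⟩ʳ fromℕ< (bound u))

  proper' : IsColoring G c'
  proper' = permute-colours {G = G} proper bound τ

  c'v≡k : c' v ≡ k
  c'v≡k = trans (cong toℕ (transpose-sends (fromℕ< (bound v)) top)) (Finₚ.toℕ-fromℕ< (n<1+n k))

  c'<k : ∀ u → Adj G u v → c' u < k
  c'<k u u~v = ≤∧≢⇒< (s≤s⁻¹ (Finₚ.toℕ<n _)) (subst (c' u ≢_) c'v≡k (proper' u v u~v))

  dominated : ∀ u → u ∉ₛ ⁅ v ⁆ → Σ[ d ∈ Fin _ ] d ∈ₛ ⁅ v ⁆ × Adj G u d × c' u < c' d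
  dominated u u∉⁅v⁆ with apex u
  ... | inj₁ u≡v = contradiction u≡v (x∉⁅y⁆⇒x≢y u∉⁅v⁆)
  ... | inj₂ v~u = v , x∈⁅x⁆ v , Adj-sym G v~u , subst (c' u <_) (sym c'v≡k) (c'<k u (Adj-sym G v~u))

  nonzero : ∀ u → u ∈ₛ ⁅ v ⁆ → c' u ≢ 0
  nonzero u u∈⁅v⁆ with refl ← x∈⁅y⁆⇒x≡y {x = u} {v} u∈⁅v⁆ =
    n>0⇒n≢0 (subst (0 <_) (sym c'v≡k) 1≤k)

4ab≤[a+b]² : (a b : ℕ) → 4 * (a * b) ≤ (a + b) * (a + b)
4ab≤[a+b]² a b with ≤-total a b
... | inj₁ a≤b with t , refl ← m≤n⇒∃[o]m+o≡n a≤b = ≤-trans (m≤m+n _ (t * t)) (≤-reflexive (expand a t))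
  where
  expand : ∀ a t → 4 * (a * (a + t)) + t * t ≡ (a + (a + t)) * (a + (a + t))
  expand = solve-∀
... | inj₂ b≤a with t , refl ← m≤n⇒∃[o]m+o≡n b≤a = ≤-trans (m≤m+n _ (t * t)) (≤-reflexive (expand b t))
  where
  expand : ∀ b t → 4 * ((b + t) * b) + t * t ≡ (b + t + b) * (b + t + b)
  expand = solve-∀

-- An independent set through v whose complement is smallest cannot be enlarged, so it dominates.
-- The search behind it is kept opaque so that it is never unfolded during type checking.
opaque
  maximal-independent-set : (G : Graph n) (v : Fin n) →
    Σ[ I ∈ Subset n ] IsIndependent G I × IsDominating G I × v ∈ₛ I
  maximal-independent-set {n} G v = I , independent , dominating , v∈I
    where
    P : Subset n → Set
    P I = IsIndependent G I × v ∈ₛ I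

    P? : ∀ I → Dec (P I)
    P? I = Finₚ.all? (λ u → Finₚ.all? λ w →
             (I u Boolₚ.≟ true) →-dec (I w Boolₚ.≟ true) →-dec ¬? (edge G u w Boolₚ.≟ true))
           ×-dec (I v Boolₚ.≟ true)

    P-resp : ∀ {A B} → A ≗ B → P A → P B
    P-resp A≗B (independent , v∈A) =
      (λ u w u∈B w∈B → independent u w (trans (A≗B u) u∈B) (trans (A≗B w) w∈B)) , trans (sym (A≗B v)) v∈A

    open Minimisation P? P-resp (size ∘ ∁) (λ A≗B → weight-congʳ (λ _ → 1) (cong not ∘ A≗B))

    found : Σ[ I ∈ Subset n ] P I × (∀ B → P B → size (∁ I) ≤ size (∁ B))
    found = minimiser (⁅⁆-independent G v , x∈⁅x⁆ v)

    I : Subset n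
    I = proj₁ found

    independent : IsIndependent G I
    independent = proj₁ (proj₁ (proj₂ found))

    v∈I : v ∈ₛ I
    v∈I = proj₂ (proj₁ (proj₂ found))

    dominating : IsDominating G I
    dominating x x∉I with Finₚ.any? (λ d → (I d Boolₚ.≟ true) ×-dec (edge G x d Boolₚ.≟ true))
    ... | yes (d , d∈I , x~d) = d , d∈I , x~d
    ... | no isolated = contradiction (proj₂ (proj₂ found) (⁅ x ⁆ ∪ I) (independent' , ∈∪ʳ ⁅ x ⁆ I v∈I))
          (<⇒≱ (size-⊂ {A = ∁ (⁅ x ⁆ ∪ I)} (∁-antitone {A = I} (λ _ → ∈∪ʳ ⁅ x ⁆ I))
                       (cong not x∉I) (cong not (∈∪ˡ ⁅ x ⁆ I (x∈⁅x⁆ x)))))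
      where
      independent' : IsIndependent G (⁅ x ⁆ ∪ I)
      independent' u w u∈ w∈ u~w with ∈∪⁻ ⁅ x ⁆ I u∈ | ∈∪⁻ ⁅ x ⁆ I w∈
      ... | inj₁ u∈⁅x⁆ | inj₁ w∈⁅x⁆ = ⁅⁆-independent G x u w u∈⁅x⁆ w∈⁅x⁆ u~w
      ... | inj₁ u∈⁅x⁆ | inj₂ w∈I   =
        isolated (w , w∈I , subst (λ y → Adj G y w) (x∈⁅y⁆⇒x≡y {y = x} u∈⁅x⁆) u~w)
      ... | inj₂ u∈I   | inj₁ w∈⁅x⁆ =
        isolated (u , u∈I , Adj-sym G (subst (Adj G u) (x∈⁅y⁆⇒x≡y {y = x} w∈⁅x⁆) u~w))
      ... | inj₂ u∈I   | inj₂ w∈I   = independent u w u∈I w∈I u~w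

χ≤size-∁ : {G : Graph n} {χ : ℕ} {I : Subset n} {p q : Fin n} → IsChromatic G χ → IsIndependent G I →
  p ∉ₛ I → q ∉ₛ I → p ≢ q → ¬ Adj G p q → χ ≤ size (∁ I)
χ≤size-∁ {n} {G} {I = I} {p} {q} (_ , least) independent p∉I q∉I p≢q p≁q =
  least _ (colourable-by-rank G (∁ I) φ φ∈∁I φ-separates)
  where
  -- φ collapses I onto q and q onto p; its fibres are independent, so ranking φ z inside ∁ I colours G.
  φ : Fin n → Fin n
  φ z = if I z then q else (if does (z ≟ q) then p else z)

  φ∈∁I : ∀ z → φ z ∈ₛ ∁ I
  φ∈∁I z with I z in z∈I | z ≟ q
  ... | true  | _     = cong not q∉I
  ... | false | yes _ = cong not p∉I
  ... | false | no _  = cong not z∈I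

  φ-separates : ∀ u w → Adj G u w → φ u ≢ φ w
  φ-separates u w u~w with I u in u∈I | I w in w∈I | u ≟ q | w ≟ q
  ... | true  | true  | _        | _        = λ _ → independent u w u∈I w∈I u~w
  ... | true  | false | _        | yes _    = p≢q ∘ sym
  ... | true  | false | _        | no w≢q   = w≢q ∘ sym
  ... | false | true  | yes _    | _        = p≢q
  ... | false | true  | no u≢q   | _        = u≢q
  ... | false | false | yes refl | yes refl = λ _ → Adj⇒≢ G u~w refl
  ... | false | false | yes refl | no _     = λ p≡w → p≁q (Adj-sym G (subst (Adj G u) (sym p≡w) u~w))
  ... | false | false | no _     | yes refl = λ u≡p → p≁q (subst (λ y → Adj G y w) u≡p u~w)
  ... | false | false | no _     | no _     = Adj⇒≢ G u~w

-- If ∁ I is a clique, a vertex outside I ∪ N(v), or a neighbour of a second vertex of I, would have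
-- larger degree than v.
module MaximumDegreeApex {G : Graph n} (connected : Connected G)
  {v : Fin n} (maximum : ∀ u → degree G u ≤ degree G v) {I : Subset n} (independent : IsIndependent G I) (dominating : IsDominating G I) (v∈I : v ∈ₛ I)
  (clique : ∀ p q → p ∉ₛ I → q ∉ₛ I → p ≢ q → Adj G p q) where

  outside⇒adjacent : ∀ a → a ∉ₛ I → Adj G v a
  outside⇒adjacent a a∉I with edge G v a in v~a | dominating a a∉I
  ... | true  | _             = refl
  ... | false | m , m∈I , a~m =
    contradiction (maximum a) (<⇒≱ (size-⊂ {A = edge G v} N[v]⊆N[a] a~m (Boolₚ.¬-not (independent v m v∈I m∈I))))
    where
    N[v]⊆N[a] : edge G v ⊆ₛ edge G a
    N[v]⊆N[a] z v~z = clique a z a∉I (independent-∉ {G = G} independent v∈I v~z) a≢z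
      where
      a≢z : a ≢ z
      a≢z refl with () ← trans (sym v~z) v~a

  inside⇒apex : ∀ x → x ∈ₛ I → x ≡ v
  inside⇒apex x x∈I with x ≟ v
  ... | yes x≡v = x≡v
  ... | no x≢v  with neighbour (connected x v) x≢v
  ...   | y , x~y = contradiction (maximum y) (<⇒≱ (s≤s⁻¹ (begin-strict
    suc (degree G v)       ≡⟨ size-closedNbhd G v ⟨
    size (closedNbhd G v)  <⟨ size-⊂ {A = closedNbhd G v} N[v]⊆N[y] x∈N[y] x∉N[v] ⟩
    size (closedNbhd G y)  ≡⟨ size-closedNbhd G y ⟩
    suc (degree G y)       ∎)))
    where
    open ≤-Reasoning
    y∉I : y ∉ₛ I
    y∉I = independent-∉ {G = G} independent x∈I x~y
    N[v]⊆N[y] : closedNbhd G v ⊆ₛ closedNbhd G y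
    N[v]⊆N[y] z z∈N[v] with ∈closedNbhd⁻ G z∈N[v]
    ... | inj₁ refl = Adj⇒∈closedNbhd G (Adj-sym G (outside⇒adjacent y y∉I))
    ... | inj₂ v~z with y ≟ z
    ...   | yes refl = self∈closedNbhd G y
    ...   | no y≢z   = Adj⇒∈closedNbhd G (clique y z y∉I (independent-∉ {G = G} independent v∈I v~z) y≢z)
    x∈N[y] : x ∈ₛ closedNbhd G y
    x∈N[y] = Adj⇒∈closedNbhd G (Adj-sym G x~y)
    x∉N[v] : x ∉ₛ closedNbhd G v
    x∉N[v] = ∉closedNbhd G x≢v (independent v x v∈I x∈I)

module _ {G : Graph n} {χ ι : ℕ} (4≤n : 4 ≤ n) (connected : Connected G)
         (hχ : IsChromatic G χ) (hι : IsIndDomNumber G ι) where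

  private
    maximum-degree : Σ[ v ∈ Fin n ] (∀ u → degree G u ≤ degree G v)
    maximum-degree = argmax-vertex (fromℕ< (≤-trans (s≤s z≤n) 4≤n)) (degree G)

    v : Fin n
    v = proj₁ maximum-degree

    I : Subset n
    I = proj₁ (maximal-independent-set G v)

    independent : IsIndependent G I
    independent = proj₁ (proj₂ (maximal-independent-set G v))

    dominating : IsDominating G I
    dominating = proj₁ (proj₂ (proj₂ (maximal-independent-set G v)))

    ι≤size-I : ι ≤ size I
    ι≤size-I = proj₂ hι I independent dominating

    nonadjacent-pair? : ∀ p → Dec (Σ[ q ∈ Fin n ] p ∉ₛ I × q ∉ₛ I × p ≢ q × ¬ Adj G p q)
    nonadjacent-pair? p = Finₚ.any? λ q →
      (I p Boolₚ.≟ false) ×-dec (I q Boolₚ.≟ false) ×-dec ¬? (p ≟ q) ×-dec ¬? (edge G p q Boolₚ.≟ true)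

  4ιχ≤n² : 4 * (ι * χ) ≤ n * n
  4ιχ≤n² with Finₚ.any? nonadjacent-pair?
  ... | yes (p , q , p∉I , q∉I , p≢q , p≁q) = begin
    4 * (ι * χ)                                   ≤⟨ *-monoʳ-≤ 4 (*-mono-≤ ι≤size-I χ≤size-∁I) ⟩
    4 * (size I * size (∁ I))                     ≤⟨ 4ab≤[a+b]² (size I) (size (∁ I)) ⟩
    (size I + size (∁ I)) * (size I + size (∁ I)) ≡⟨ cong (λ m → m * m) (size-∁ I) ⟩
    n * n                                         ∎
    where
    open ≤-Reasoning
    χ≤size-∁I : χ ≤ size (∁ I)
    χ≤size-∁I = χ≤size-∁ {G = G} hχ independent p∉I q∉I p≢q p≁q
  ... | no no-pair = begin
    4 * (ι * χ) ≤⟨ *-monoʳ-≤ 4 (*-mono-≤ ι≤1 (χ≤n {G = G} hχ)) ⟩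
    4 * (1 * n) ≡⟨ cong (4 *_) (*-identityˡ n) ⟩
    4 * n       ≤⟨ *-monoˡ-≤ n 4≤n ⟩
    n * n       ∎
    where
    open ≤-Reasoning
    clique : ∀ p q → p ∉ₛ I → q ∉ₛ I → p ≢ q → Adj G p q
    clique p q p∉I q∉I p≢q with edge G p q Boolₚ.≟ true
    ... | yes p~q = p~q
    ... | no p≁q  = contradiction (p , q , p∉I , q∉I , p≢q , p≁q) no-pair
    open MaximumDegreeApex connected (proj₂ maximum-degree) independent dominating
                           (proj₂ (proj₂ (proj₂ (maximal-independent-set G v)))) clique
    ι≤1 : ι ≤ 1
    ι≤1 = begin
      ι          ≤⟨ ι≤size-I ⟩
      size I     ≤⟨ weight-monoʳ (λ _ → 1) {I} I⊆⁅v⁆ ⟩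
      size ⁅ v ⁆ ≡⟨ weight-⁅⁆ (λ _ → 1) v ⟩
      1          ∎
      where
      I⊆⁅v⁆ : I ⊆ₛ ⁅ v ⁆
      I⊆⁅v⁆ x x∈I = subst (_∈ₛ ⁅ v ⁆) (sym (inside⇒apex x x∈I)) (x∈⁅x⁆ v)

theorem4 : ∀ (n : ℕ) → 5 ≤ n → (G : Graph n) → Connected G →
    ∀ (χ γ ι Ω : ℕ) →
    IsChromatic G χ → IsDomNumber G γ → IsIndDomNumber G ι → IsBigOmegaUC G Ω →
    ((χ ∸ 1) ⊔ γ ≤ Ω)
    × (2 * Ω ≤ (3 * (χ ∸ 1) * γ) ⊓ (2 * (ι * χ)))
    × (2 * ((3 * (χ ∸ 1) * γ) ⊓ (2 * (ι * χ))) ≤ n * n)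
    × ((χ ∸ 1 ≡ Ω) ⇔ IsCone G)
theorem4 n 5≤n G connected χ γ ι Ω hχ hγ hι hΩ@((_ , proper , (D , ucd , weight≡Ω) , _) , _) =
  ⊔-lub χ∸1≤Ω (γ≤Ω {G = G} hγ hΩ) ,
  ⊓-glb (2Ω≤3[χ∸1]γ {G = G} 2≤χ hχ hγ hΩ) (*-monoʳ-≤ 2 (Ω≤ιχ {G = G} (<⇒≤ 2≤χ) hχ hι hΩ)) ,
  (begin
    2 * ((3 * (χ ∸ 1) * γ) ⊓ (2 * (ι * χ))) ≤⟨ *-monoʳ-≤ 2 (m⊓n≤n (3 * (χ ∸ 1) * γ) (2 * (ι * χ))) ⟩
    2 * (2 * (ι * χ))                       ≡⟨ *-assoc 2 2 (ι * χ) ⟨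
    4 * (ι * χ)                             ≤⟨ 4ιχ≤n² (≤-trans (n≤1+n 4) 5≤n) connected hχ hι ⟩
    n * n                                   ∎) ,
  mk⇔ (λ χ∸1≡Ω → weight≤χ∸1⇒cone hχ (≤-reflexive (trans weight≡Ω (sym χ∸1≡Ω))))
      (λ cone → ≤-antisym χ∸1≤Ω (cone⇒Ω≤χ∸1 {G = G} 2≤χ hχ hΩ cone))
  where
  open ≤-Reasoning
  some-edge : Σ[ u ∈ Fin n ] Σ[ w ∈ Fin n ] Adj G u w
  some-edge = connected⇒edge (≤-trans (s≤s (s≤s z≤n)) 5≤n) connected
  2≤χ : 2 ≤ χ
  2≤χ = edge⇒2≤χ {G = G} hχ (proj₂ (proj₂ some-edge))
  open UCDSet {G = G} proper ucd (proj₁ some-edge)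
  χ∸1≤Ω : χ ∸ 1 ≤ Ω
  χ∸1≤Ω = subst (χ ∸ 1 ≤_) weight≡Ω (χ∸1≤weight hχ)
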